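{- There is an absolute constant $C$ such that for every $n$-vertex graph $G$, $\mathrm{fc}_+(\mathrm{IndependentSet}(G),2\sqrt n)\le Cn$; that is, $\mathrm{IndependentSet}(G)$ has a factor-$2\sqrt n$ LP relaxation with $O(n)$ inequalities.
   Context: For a graph $G=(V,E)$, $\mathrm{IndependentSet}(G)$ is the maximization problem whose feasible solutions are all independent sets $I$ of $G$, with one instance $\mathcal I(H)$ for each induced subgraph $H$ of $G$ and $\mathrm{Val}_{\mathcal I(H)}(I)=|I\cap V(H)|$; $\mathrm{OPT}(\mathcal I)=\max_I\mathrm{Val}_{\mathcal I}(I)$. For $\rho\ge1$, a factor-$\rho$ LP relaxation of this maximization problem is a linear system $Ax\ge b$ in $\mathbb R^d$ ($d$ arbitrary) with vectors $x^I$ satisfying $Ax^I\ge b$ for every independent set $I$ and affine functions $f_{\mathcal I}$ with $f_{\mathcal I}(x^I)=\mathrm{Val}_{\mathcal I}(I)$ for all $I,\mathcal I$, such that $\max\{f_{\mathcal I}(x):Ax\ge b\}\le\rho\,\mathrm{OPT}(\mathcal I)$ for every instance. The size is the number of inequalities (the system may be arbitrary, with no bound on the computation needed to construct it); $\mathrm{fc}_+(\Pi,\rho)$ is the minimum size of a factor-$\rho$ LP relaxation. -}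

module Defs where

open import Data.Nat as ℕ using (ℕ; zero; suc)
open import Data.Bool using (Bool; true; false; _∧_; not; if_then_else_)
open import Data.Bool.ListAction using (all)
open import Data.Fin using (Fin)
open import Data.Fin.Subset using (Subset; _∩_; ∣_∣; inside; outside)
open import Data.Vec using (Vec; []; _∷_; lookup)
open import Data.List using (List; []; _∷_; map; _++_; foldr; allFin)
open import Data.Integer using (+_)
open import Data.Rational using (ℚ; 0ℚ; _+_; _*_; _≤_; _≥_; _/_)
open import Data.Sum using (_⊎_)
open import Relation.Binary.PropositionalEquality using (_≡_)

record Graph (n : ℕ) : Set where
  field
    adj    : Fin n → Fin n → Bool
    sym    : ∀ u v → adj u v ≡ adj v u
    irrefl : ∀ u → adj u u ≡ false
open Graph public

independent? : ∀ {n} → Graph n → Subset n → Bool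
independent? {n} G I =
  all (λ u → all (λ v → not (lookup I u ∧ lookup I v ∧ adj G u v)) (allFin n)) (allFin n)

IsIndependent : ∀ {n} → Graph n → Subset n → Set
IsIndependent G I = independent? G I ≡ true

allSubsets : (n : ℕ) → List (Subset n)
allSubsets zero = [] ∷ []
allSubsets (suc n) = map (inside ∷_) (allSubsets n) ++ map (outside ∷_) (allSubsets n)

-- Instances I(H) are indexed by the vertex set S = V(H) of the induced subgraph H.
-- Val_{I(H)}(I) = |I ∩ V(H)|.
Val : ∀ {n} → Subset n → Subset n → ℕ
Val S I = ∣ I ∩ S ∣

OPT : ∀ {n} → Graph n → Subset n → ℕ
OPT {n} G S =
  foldr (λ I m → if independent? G I then ℕ._⊔_ (Val S I) m else m) 0 (allSubsets n)

sumFin : (d : ℕ) → (Fin d → ℚ) → ℚ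
sumFin zero f = 0ℚ
sumFin (suc d) f = f Fin.zero + sumFin d (λ j → f (Fin.suc j))

ℕ→ℚ : ℕ → ℚ
ℕ→ℚ k = (+ k) / 1

record LinSystem (m d : ℕ) : Set where
  field
    A : Fin m → Fin d → ℚ
    b : Fin m → ℚ
open LinSystem public

Feasible : ∀ {m d} → LinSystem m d → (Fin d → ℚ) → Set
Feasible {m} {d} L x = ∀ (i : Fin m) → sumFin d (λ j → A L i j * x j) ≥ b L i

record Affine (d : ℕ) : Set where
  field
    c0 : ℚ
    c  : Fin d → ℚ
open Affine public

eval : ∀ {d} → Affine d → (Fin d → ℚ) → ℚ
eval {d} f x = c0 f + sumFin d (λ j → c f j * x j)

-- y ≤ 2 √n · z  for z ≥ 0, written without square roots:
-- y ≤ 0, or y² ≤ 4 n z².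
LeTwoSqrtTimes : ℕ → ℚ → ℚ → Set
LeTwoSqrtTimes n y z = (y ≤ 0ℚ) ⊎ (y * y ≤ ℕ→ℚ (4 ℕ.* n) * (z * z))

record Factor2SqrtNRelaxation {n : ℕ} (G : Graph n) (m : ℕ) : Set where
  field
    d        : ℕ
    system   : LinSystem m d
    embed    : Subset n → (Fin d → ℚ)
    embed-ok : ∀ I → IsIndependent G I → Feasible system (embed I)
    obj      : Subset n → Affine d
    obj-ok   : ∀ S I → IsIndependent G I → eval (obj S) (embed I) ≡ ℕ→ℚ (Val S I)
    bound    : ∀ S x → Feasible system x →
               LeTwoSqrtTimes n (eval (obj S) x) (ℕ→ℚ (OPT G S))

module Submission where

-- Greedily remove s = ⌊√n⌋ maximum independent sets L₁, …, L_s from G and let T be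
-- the remaining vertices.  T and every L_i have at least α(T) vertices, so
-- (s + 1)·α(T) ≤ n and hence α(T) ≤ s.  For every S, the part S ∖ T is covered by
-- the s independent sets L_i ∩ S, so |S ∖ T| ≤ s·OPT(S).
--
-- The relaxation is the nonnegative orthant in ℚ^(1+n).  An independent set I is
-- encoded by the slack α(T) − |I ∩ T| and, for each vertex v, the indicator of v ∈ I
-- if v ∈ T and of v ∉ I if v ∉ T.  For OPT(S) > 0 the objective of S is
--   |S ∖ T| + α(T) − x₀ − Σ_{v ∈ T ∖ S} x_v − Σ_{v ∈ S ∖ T} x_v,
-- which equals |I ∩ S| on encodings and is at most |S ∖ T| + α(T) ≤ 2s·OPT(S) on the
-- orthant; for OPT(S) = 0 the objective is 0.  This uses n + 1 ≤ 2n inequalities.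

open import Defs hiding (sym)
open import Data.Nat using (ℕ; _*_; _≤_)
open import Data.Product using (Σ; ∃; _×_)

open import Data.Nat using (zero; suc; _+_; _∸_; _⊔_; _<_; _≤?_; _<?_; z≤n; s≤s)
import Data.Nat.Properties as ℕ
open import Data.Nat.Tactic.RingSolver using (solve-∀)
open import Algebra.Properties.CommutativeSemigroup ℕ.+-commutativeSemigroup
  using () renaming (interchange to +-interchange)
open import Algebra.Properties.Monoid.Sum ℕ.+-0-monoid using (sum; sum-replicate-zero)
import Data.Nat.Coprimality as Coprimality
import Data.Integer as ℤ
import Data.Integer.Properties as ℤ
open import Data.Rational as Q using (ℚ; 0ℚ; 1ℚ; mkℚ; toℚᵘ; *≤*)
import Data.Rational.Properties as QP
import Data.Rational.Unnormalised as U
import Data.Rational.Unnormalised.Properties as UP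
open import Data.Bool using (Bool; true; false; _∧_; not; if_then_else_)
import Data.Bool as Bool
open import Data.Bool.Properties using (T-≡)
open import Data.Fin using (Fin)
open import Data.Fin.Subset using (Subset; _∩_; _⊆_; ∣_∣; ∁; ⊤; ⊥)
open import Data.Fin.Subset.Properties
  using (∣p∩q∣≤∣q∣; p⊆q⇒∣p∣≤∣q∣; p∩q⊆p; x∈p∩q⁺; x∈p∩q⁻; ∩-comm; ∩-assoc; ∩-identityʳ; ∩-zeroˡ; ∣⊥∣≡0; ∣⊤∣≡n)
open import Data.Vec using ([]; _∷_; lookup)
open import Data.Vec.Properties using (lookup-replicate)
open import Data.List using ([]; _∷_; map; foldr; allFin)
open import Data.List.Membership.Propositional using (_∈_)
open import Data.List.Membership.Propositional.Properties using (∈-map⁺; ∈-++⁺ˡ; ∈-++⁺ʳ)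
open import Data.List.Relation.Unary.Any using (here; there)
import Data.List.Relation.Unary.All as All
open import Data.List.Relation.Unary.All.Properties using (all⁻)
open import Data.Sum using (inj₁; inj₂)
open import Data.Product using (_,_; proj₁; proj₂)
open import Function using (_∘_; Equivalence)
open import Relation.Nullary using (yes; no)
open import Relation.Binary.PropositionalEquality

private
  ℕ→ℚ≡mkℚ : ∀ k → ℕ→ℚ k ≡ mkℚ (ℤ.+ k) 0 (Coprimality.sym (Coprimality.1-coprimeTo k))
  ℕ→ℚ≡mkℚ k = QP.↥p/↧p≡p _

ℕ→ℚ-homo-+ : ∀ a b → ℕ→ℚ (a + b) ≡ ℕ→ℚ a Q.+ ℕ→ℚ b
ℕ→ℚ-homo-+ a b = QP.toℚᵘ-injective (UP.≃-trans unnormalised (UP.≃-sym (QP.toℚᵘ-homo-+ (ℕ→ℚ a) (ℕ→ℚ b))))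
  where
  unnormalised : toℚᵘ (ℕ→ℚ (a + b)) U.≃ toℚᵘ (ℕ→ℚ a) U.+ toℚᵘ (ℕ→ℚ b)
  unnormalised rewrite ℕ→ℚ≡mkℚ a | ℕ→ℚ≡mkℚ b | ℕ→ℚ≡mkℚ (a + b) =
    U.*≡* (cong (ℤ._* ℤ.+ 1) (trans (ℤ.pos-+ a b) (sym (cong₂ ℤ._+_ (ℤ.*-identityʳ (ℤ.+ a)) (ℤ.*-identityʳ (ℤ.+ b))))))

ℕ→ℚ-homo-* : ∀ a b → ℕ→ℚ (a * b) ≡ ℕ→ℚ a Q.* ℕ→ℚ b
ℕ→ℚ-homo-* a b = QP.toℚᵘ-injective (UP.≃-trans unnormalised (UP.≃-sym (QP.toℚᵘ-homo-* (ℕ→ℚ a) (ℕ→ℚ b))))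
  where
  unnormalised : toℚᵘ (ℕ→ℚ (a * b)) U.≃ toℚᵘ (ℕ→ℚ a) U.* toℚᵘ (ℕ→ℚ b)
  unnormalised rewrite ℕ→ℚ≡mkℚ a | ℕ→ℚ≡mkℚ b | ℕ→ℚ≡mkℚ (a * b) = U.*≡* (cong (ℤ._* ℤ.+ 1) (ℤ.pos-* a b))

ℕ→ℚ-mono-≤ : ∀ {a b} → a ≤ b → ℕ→ℚ a Q.≤ ℕ→ℚ b
ℕ→ℚ-mono-≤ {a} {b} a≤b rewrite ℕ→ℚ≡mkℚ a | ℕ→ℚ≡mkℚ b =
  *≤* (subst₂ ℤ._≤_ (sym (ℤ.*-identityʳ (ℤ.+ a))) (sym (ℤ.*-identityʳ (ℤ.+ b))) (ℤ.+≤+ a≤b))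

ℕ→ℚ-nonNeg : ∀ a → 0ℚ Q.≤ ℕ→ℚ a
ℕ→ℚ-nonNeg a = ℕ→ℚ-mono-≤ {0} {a} z≤n

ℕ→ℚ[m+n]-ℕ→ℚ[n]≡ℕ→ℚ[m] : ∀ m n → ℕ→ℚ (m + n) Q.- ℕ→ℚ n ≡ ℕ→ℚ m
ℕ→ℚ[m+n]-ℕ→ℚ[n]≡ℕ→ℚ[m] m n rewrite ℕ→ℚ-homo-+ m n | QP.+-assoc (ℕ→ℚ m) (ℕ→ℚ n) (Q.- ℕ→ℚ n) | QP.+-inverseʳ (ℕ→ℚ n) =
  QP.+-identityʳ (ℕ→ℚ m)

sumFin-cong : ∀ d {f g : Fin d → ℚ} → (∀ j → f j ≡ g j) → sumFin d f ≡ sumFin d g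
sumFin-cong zero    f≗g = refl
sumFin-cong (suc d) f≗g = cong₂ Q._+_ (f≗g Fin.zero) (sumFin-cong d (f≗g ∘ Fin.suc))

sumFin-neg : ∀ d (f : Fin d → ℚ) → sumFin d (λ j → Q.- f j) ≡ Q.- sumFin d f
sumFin-neg zero    f = refl
sumFin-neg (suc d) f =
  trans (cong (Q.- f Fin.zero Q.+_) (sumFin-neg d (f ∘ Fin.suc))) (sym (QP.neg-distrib-+ (f Fin.zero) (sumFin d (f ∘ Fin.suc))))

sumFin-ℕ→ℚ : ∀ d (f : Fin d → ℕ) → sumFin d (λ j → ℕ→ℚ (f j)) ≡ ℕ→ℚ (sum f)
sumFin-ℕ→ℚ zero    f = refl
sumFin-ℕ→ℚ (suc d) f =
  trans (cong (ℕ→ℚ (f Fin.zero) Q.+_) (sumFin-ℕ→ℚ d (f ∘ Fin.suc))) (sym (ℕ→ℚ-homo-+ (f Fin.zero) (sum (f ∘ Fin.suc))))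

sumFin-nonNeg : ∀ d {f : Fin d → ℚ} → (∀ j → 0ℚ Q.≤ f j) → 0ℚ Q.≤ sumFin d f
sumFin-nonNeg zero    f≥0 = QP.≤-refl
sumFin-nonNeg (suc d) f≥0 = QP.+-mono-≤ (f≥0 Fin.zero) (sumFin-nonNeg d (f≥0 ∘ Fin.suc))

sumFin-0* : ∀ d (x : Fin d → ℚ) → sumFin d (λ j → 0ℚ Q.* x j) ≡ 0ℚ
sumFin-0* zero    x = refl
sumFin-0* (suc d) x rewrite QP.*-zeroˡ (x Fin.zero) | sumFin-0* d (x ∘ Fin.suc) = refl

δ : ∀ {d} → Fin d → Fin d → ℚ
δ Fin.zero    Fin.zero    = 1ℚ
δ Fin.zero    (Fin.suc j) = 0ℚ
δ (Fin.suc i) Fin.zero    = 0ℚ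
δ (Fin.suc i) (Fin.suc j) = δ i j

sumFin-δ : ∀ d (i : Fin d) (x : Fin d → ℚ) → sumFin d (λ j → δ i j Q.* x j) ≡ x i
sumFin-δ (suc d) Fin.zero x
  rewrite sumFin-0* d (x ∘ Fin.suc) | QP.*-identityˡ (x Fin.zero) = QP.+-identityʳ (x Fin.zero)
sumFin-δ (suc d) (Fin.suc i) x
  rewrite sumFin-δ d i (x ∘ Fin.suc) | QP.*-zeroˡ (x Fin.zero) = QP.+-identityˡ (x (Fin.suc i))

orthant : (d : ℕ) → LinSystem d d
orthant d = record { A = δ ; b = λ _ → 0ℚ }

feasible-orthant⁺ : ∀ {d} {x : Fin d → ℚ} → (∀ j → 0ℚ Q.≤ x j) → Feasible (orthant d) x
feasible-orthant⁺ {d} {x} x≥0 i = subst (0ℚ Q.≤_) (sym (sumFin-δ d i x)) (x≥0 i)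

feasible-orthant⁻ : ∀ {d} {x : Fin d → ℚ} → Feasible (orthant d) x → ∀ j → 0ℚ Q.≤ x j
feasible-orthant⁻ {d} {x} feasible j = subst (0ℚ Q.≤_) (sumFin-δ d j x) (feasible j)

ℕ-affine : ∀ {d} → ℕ → (Fin d → ℕ) → Affine d
ℕ-affine b k = record { c0 = ℕ→ℚ b ; c = λ j → Q.- ℕ→ℚ (k j) }

eval-ℕ-affine : ∀ {d} b (k : Fin d → ℕ) (x : Fin d → ℚ) →
                eval (ℕ-affine b k) x ≡ ℕ→ℚ b Q.- sumFin d (λ j → ℕ→ℚ (k j) Q.* x j)
eval-ℕ-affine {d} b k x = cong (ℕ→ℚ b Q.+_) (begin
  sumFin d (λ j → Q.- ℕ→ℚ (k j) Q.* x j)    ≡⟨ sumFin-cong d (λ j → sym (QP.neg-distribˡ-* (ℕ→ℚ (k j)) (x j))) ⟩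
  sumFin d (λ j → Q.- (ℕ→ℚ (k j) Q.* x j))  ≡⟨ sumFin-neg d _ ⟩
  Q.- sumFin d (λ j → ℕ→ℚ (k j) Q.* x j)    ∎)
  where open ≡-Reasoning

eval-ℕ-affine-ℕ→ℚ : ∀ {d} b (k g : Fin d → ℕ) v → b ≡ v + sum (λ j → k j * g j) →
                    eval (ℕ-affine b k) (ℕ→ℚ ∘ g) ≡ ℕ→ℚ v
eval-ℕ-affine-ℕ→ℚ {d} b k g v b≡v+Σkg = begin
  eval (ℕ-affine b k) (ℕ→ℚ ∘ g)                           ≡⟨ eval-ℕ-affine b k (ℕ→ℚ ∘ g) ⟩
  ℕ→ℚ b Q.- sumFin d (λ j → ℕ→ℚ (k j) Q.* ℕ→ℚ (g j))   ≡⟨ cong (Q._-_ (ℕ→ℚ b)) (sumFin-cong d λ j → sym (ℕ→ℚ-homo-* (k j) (g j))) ⟩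
  ℕ→ℚ b Q.- sumFin d (λ j → ℕ→ℚ (k j * g j))           ≡⟨ cong (Q._-_ (ℕ→ℚ b)) (sumFin-ℕ→ℚ d (λ j → k j * g j)) ⟩
  ℕ→ℚ b Q.- ℕ→ℚ Σkg                                     ≡⟨ cong (λ c → ℕ→ℚ c Q.- ℕ→ℚ Σkg) b≡v+Σkg ⟩
  ℕ→ℚ (v + Σkg) Q.- ℕ→ℚ Σkg                             ≡⟨ ℕ→ℚ[m+n]-ℕ→ℚ[n]≡ℕ→ℚ[m] v Σkg ⟩
  ℕ→ℚ v                                                   ∎
  where
  open ≡-Reasoning
  Σkg = sum (λ j → k j * g j)

eval-ℕ-affine≤ : ∀ {d} b (k : Fin d → ℕ) (x : Fin d → ℚ) → (∀ j → 0ℚ Q.≤ x j) →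
                 eval (ℕ-affine b k) x Q.≤ ℕ→ℚ b
eval-ℕ-affine≤ {d} b k x x≥0 = begin
  eval (ℕ-affine b k) x                               ≡⟨ eval-ℕ-affine b k x ⟩
  ℕ→ℚ b Q.- sumFin d (λ j → ℕ→ℚ (k j) Q.* x j)     ≤⟨ QP.+-monoʳ-≤ (ℕ→ℚ b) (QP.neg-antimono-≤ (sumFin-nonNeg d kx≥0)) ⟩
  ℕ→ℚ b Q.+ 0ℚ                                       ≡⟨ QP.+-identityʳ (ℕ→ℚ b) ⟩
  ℕ→ℚ b                                               ∎
  where
  open QP.≤-Reasoning
  kx≥0 : ∀ j → 0ℚ Q.≤ ℕ→ℚ (k j) Q.* x j
  kx≥0 j = QP.nonNegative⁻¹ _
    {{QP.nonNeg*nonNeg⇒nonNeg (ℕ→ℚ (k j)) {{Q.nonNegative (ℕ→ℚ-nonNeg (k j))}} (x j) {{Q.nonNegative (x≥0 j)}}}}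

square-mono-≤ : ∀ {y b} → 0ℚ Q.≤ y → y Q.≤ b → y Q.* y Q.≤ b Q.* b
square-mono-≤ {y} {b} 0≤y y≤b =
  QP.≤-trans (QP.*-monoʳ-≤-nonNeg y {{Q.nonNegative 0≤y}} y≤b)
             (QP.*-monoˡ-≤-nonNeg b {{Q.nonNegative (QP.≤-trans 0≤y y≤b)}} y≤b)

LeTwoSqrtTimes-intro : ∀ n {y} b z → y Q.≤ ℕ→ℚ b → b * b ≤ 4 * n * (z * z) →
                       LeTwoSqrtTimes n y (ℕ→ℚ z)
LeTwoSqrtTimes-intro n {y} b z y≤b b²≤4nz² with QP.≤-total y 0ℚ
... | inj₁ y≤0 = inj₁ y≤0
... | inj₂ 0≤y = inj₂ (QP.≤-trans (square-mono-≤ 0≤y y≤b) (subst₂ Q._≤_ b² 4nz² (ℕ→ℚ-mono-≤ b²≤4nz²)))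
  where
  b² : ℕ→ℚ (b * b) ≡ ℕ→ℚ b Q.* ℕ→ℚ b
  b² = ℕ→ℚ-homo-* b b
  4nz² : ℕ→ℚ (4 * n * (z * z)) ≡ ℕ→ℚ (4 * n) Q.* (ℕ→ℚ z Q.* ℕ→ℚ z)
  4nz² = trans (ℕ→ℚ-homo-* (4 * n) (z * z)) (cong (ℕ→ℚ (4 * n) Q.*_) (ℕ→ℚ-homo-* z z))

b≤2sz⇒b²≤4nz² : ∀ {b s n} z → b ≤ s * z + s * z → s * s ≤ n → b * b ≤ 4 * n * (z * z)
b≤2sz⇒b²≤4nz² {b} {s} {n} z b≤2sz s²≤n = begin
  b * b                              ≤⟨ ℕ.*-mono-≤ b≤2sz b≤2sz ⟩
  (s * z + s * z) * (s * z + s * z)  ≡⟨ expand s z ⟩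
  4 * (s * s) * (z * z)              ≤⟨ ℕ.*-monoˡ-≤ (z * z) (ℕ.*-monoʳ-≤ 4 s²≤n) ⟩
  4 * n * (z * z)                    ∎
  where
  open ℕ.≤-Reasoning
  expand : ∀ s z → (s * z + s * z) * (s * z + s * z) ≡ 4 * (s * s) * (z * z)
  expand = solve-∀

isqrt : ∀ n → Σ ℕ λ s → s * s ≤ n × n < suc s * suc s
isqrt zero = 0 , z≤n , s≤s z≤n
isqrt (suc n) with isqrt n
... | s , s²≤n , n<[1+s]² with suc n <? suc s * suc s
...   | yes 1+n<[1+s]² = s , ℕ.m≤n⇒m≤1+n s²≤n , 1+n<[1+s]²
...   | no  1+n≮[1+s]² = suc s , ℕ.≮⇒≥ 1+n≮[1+s]² ,
                         ℕ.≤-<-trans n<[1+s]² (ℕ.*-mono-< (ℕ.n<1+n (suc s)) (ℕ.n<1+n (suc s)))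

bit : Bool → ℕ
bit true  = 1
bit false = 0

∣x∷p∣≡bit[x]+∣p∣ : ∀ {n} x (p : Subset n) → ∣ x ∷ p ∣ ≡ bit x + ∣ p ∣
∣x∷p∣≡bit[x]+∣p∣ true  p = refl
∣x∷p∣≡bit[x]+∣p∣ false p = refl

∣p∣≡∣p∩q∣+∣p∩∁q∣ : ∀ {n} (p q : Subset n) → ∣ p ∣ ≡ ∣ p ∩ q ∣ + ∣ p ∩ ∁ q ∣
∣p∣≡∣p∩q∣+∣p∩∁q∣ []          []          = refl
∣p∣≡∣p∩q∣+∣p∩∁q∣ (true  ∷ p) (true  ∷ q) = cong suc (∣p∣≡∣p∩q∣+∣p∩∁q∣ p q)
∣p∣≡∣p∩q∣+∣p∩∁q∣ (true  ∷ p) (false ∷ q) = trans (cong suc (∣p∣≡∣p∩q∣+∣p∩∁q∣ p q)) (sym (ℕ.+-suc _ _))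
∣p∣≡∣p∩q∣+∣p∩∁q∣ (false ∷ p) (true  ∷ q) = ∣p∣≡∣p∩q∣+∣p∩∁q∣ p q
∣p∣≡∣p∩q∣+∣p∩∁q∣ (false ∷ p) (false ∷ q) = ∣p∣≡∣p∩q∣+∣p∩∁q∣ p q

∩-monoʳ-⊆ : ∀ {n} (p : Subset n) {q r : Subset n} → q ⊆ r → p ∩ q ⊆ p ∩ r
∩-monoʳ-⊆ p {q} q⊆r x∈p∩q = let x∈p , x∈q = x∈p∩q⁻ p q x∈p∩q in x∈p∩q⁺ (x∈p , q⊆r x∈q)

∅-independent : ∀ {n} (G : Graph n) → IsIndependent G ⊥
∅-independent {n} G =
  Equivalence.to T-≡ (all⁻ _ (All.universal (λ u → all⁻ _ (All.universal (edge-free u) (allFin n))) (allFin n)))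
  where
  edge-free : ∀ u v → Bool.T (not (lookup (⊥ {n}) u ∧ lookup (⊥ {n}) v ∧ adj G u v))
  edge-free u v rewrite lookup-replicate u false = _

allSubsets-complete : ∀ {n} (p : Subset n) → p ∈ allSubsets n
allSubsets-complete []                = here refl
allSubsets-complete {suc n} (true  ∷ p) = ∈-++⁺ˡ (∈-map⁺ (true ∷_) (allSubsets-complete p))
allSubsets-complete {suc n} (false ∷ p) = ∈-++⁺ʳ (map (true ∷_) (allSubsets n)) (∈-map⁺ (false ∷_) (allSubsets-complete p))

module _ {n} (G : Graph n) (S : Subset n) where

  private
    maxStep : Subset n → ℕ → ℕ
    maxStep I m = if independent? G I then Val S I ⊔ m else m

    Val≤foldr : ∀ Is I → I ∈ Is → IsIndependent G I → Val S I ≤ foldr maxStep 0 Is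
    Val≤foldr (J ∷ Is) I (here refl) I-ind rewrite I-ind = ℕ.m≤m⊔n _ _
    Val≤foldr (J ∷ Is) I (there I∈Is) I-ind with independent? G J
    ... | true  = ℕ.≤-trans (Val≤foldr Is I I∈Is I-ind) (ℕ.m≤n⊔m _ _)
    ... | false = Val≤foldr Is I I∈Is I-ind

    foldr-attained : ∀ Is → Σ (Subset n) λ L → IsIndependent G L × Val S L ≡ foldr maxStep 0 Is
    foldr-attained [] = ⊥ , ∅-independent G , trans (cong ∣_∣ (∩-zeroˡ S)) (∣⊥∣≡0 n)
    foldr-attained (J ∷ Is) with independent? G J in J-ind
    ... | false = foldr-attained Is
    ... | true with Val S J ≤? foldr maxStep 0 Is
    ...   | yes J≤ = let L , L-ind , L≡ = foldr-attained Is in L , L-ind , trans L≡ (sym (ℕ.m≤n⇒m⊔n≡n J≤))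
    ...   | no  J≰ = J , J-ind , sym (ℕ.m≥n⇒m⊔n≡m (ℕ.<⇒≤ (ℕ.≰⇒> J≰)))

  Val≤OPT : ∀ I → IsIndependent G I → Val S I ≤ OPT G S
  Val≤OPT I = Val≤foldr (allSubsets n) I (allSubsets-complete I)

  OPT-attained : Σ (Subset n) λ L → IsIndependent G L × Val S L ≡ OPT G S
  OPT-attained = foldr-attained (allSubsets n)

OPT≤∣S∣ : ∀ {n} (G : Graph n) S → OPT G S ≤ ∣ S ∣
OPT≤∣S∣ G S = let L , _ , L≡ = OPT-attained G S in subst (_≤ ∣ S ∣) L≡ (∣p∩q∣≤∣q∣ L S)

OPT-mono-⊆ : ∀ {n} (G : Graph n) {S S′} → S ⊆ S′ → OPT G S ≤ OPT G S′
OPT-mono-⊆ G {S} {S′} S⊆S′ =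
  let L , L-ind , L≡ = OPT-attained G S
  in subst (_≤ OPT G S′) L≡ (ℕ.≤-trans (p⊆q⇒∣p∣≤∣q∣ (∩-monoʳ-⊆ L S⊆S′)) (Val≤OPT G S′ L L-ind))

∣S∩T∣≤OPT[S]+∣S∩[T∖L]∣ : ∀ {n} (G : Graph n) S T {L} → IsIndependent G L →
                          ∣ S ∩ T ∣ ≤ OPT G S + ∣ S ∩ (T ∩ ∁ L) ∣
∣S∩T∣≤OPT[S]+∣S∩[T∖L]∣ G S T {L} L-ind = begin
  ∣ S ∩ T ∣                              ≡⟨ ∣p∣≡∣p∩q∣+∣p∩∁q∣ (S ∩ T) L ⟩
  ∣ (S ∩ T) ∩ L ∣ + ∣ (S ∩ T) ∩ ∁ L ∣  ≤⟨ ℕ.+-mono-≤ (ℕ.≤-trans (p⊆q⇒∣p∣≤∣q∣ S∩T∩L⊆L∩S) (Val≤OPT G S L L-ind))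
                                                        (ℕ.≤-reflexive (cong ∣_∣ (∩-assoc S T (∁ L)))) ⟩
  OPT G S + ∣ S ∩ (T ∩ ∁ L) ∣           ∎
  where
  open ℕ.≤-Reasoning
  S∩T∩L⊆L∩S : (S ∩ T) ∩ L ⊆ L ∩ S
  S∩T∩L⊆L∩S x∈ = let x∈S∩T , x∈L = x∈p∩q⁻ (S ∩ T) L x∈ in x∈p∩q⁺ (x∈L , proj₁ (x∈p∩q⁻ S T x∈S∩T))

-- Peeling

module Peeling {n} (G : Graph n) where

  maxIndependent : Subset n → Subset n
  maxIndependent T = proj₁ (OPT-attained G T)

  peel : ℕ → Subset n
  peel zero    = ⊤
  peel (suc k) = peel k ∩ ∁ (maxIndependent (peel k))

  ∣T∣≡OPT[T]+∣T∖maxIndependent∣ : ∀ T → ∣ T ∣ ≡ OPT G T + ∣ T ∩ ∁ (maxIndependent T) ∣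
  ∣T∣≡OPT[T]+∣T∖maxIndependent∣ T =
    let L , _ , L≡ = OPT-attained G T
    in trans (∣p∣≡∣p∩q∣+∣p∩∁q∣ T L) (cong (_+ ∣ T ∩ ∁ L ∣) (trans (cong ∣_∣ (∩-comm T L)) L≡))

  k*OPT[peel]+∣peel∣≤n : ∀ k → k * OPT G (peel k) + ∣ peel k ∣ ≤ n
  k*OPT[peel]+∣peel∣≤n zero    = ℕ.≤-reflexive (∣⊤∣≡n n)
  k*OPT[peel]+∣peel∣≤n (suc k) = begin
    suc k * OPT G P′ + ∣ P′ ∣         ≤⟨ ℕ.+-monoˡ-≤ ∣ P′ ∣ (ℕ.*-monoʳ-≤ (suc k) OPT[P′]≤OPT[P]) ⟩
    suc k * OPT G P + ∣ P′ ∣          ≡⟨ regroup k (OPT G P) ∣ P′ ∣ ⟩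
    k * OPT G P + (OPT G P + ∣ P′ ∣)  ≡⟨ cong (k * OPT G P +_) (sym (∣T∣≡OPT[T]+∣T∖maxIndependent∣ P)) ⟩
    k * OPT G P + ∣ P ∣               ≤⟨ k*OPT[peel]+∣peel∣≤n k ⟩
    n                                 ∎
    where
    open ℕ.≤-Reasoning
    P = peel k
    P′ = peel (suc k)
    OPT[P′]≤OPT[P] : OPT G P′ ≤ OPT G P
    OPT[P′]≤OPT[P] = OPT-mono-⊆ G (p∩q⊆p P (∁ (maxIndependent P)))
    regroup : ∀ k a c → (a + k * a) + c ≡ k * a + (a + c)
    regroup = solve-∀

  ∣S∖peel∣≤k*OPT[S] : ∀ S k → ∣ S ∩ ∁ (peel k) ∣ ≤ k * OPT G S
  ∣S∖peel∣≤k*OPT[S] S k = ℕ.+-cancelˡ-≤ ∣ S ∩ peel k ∣ _ _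
    (subst (_≤ ∣ S ∩ peel k ∣ + k * OPT G S) (∣p∣≡∣p∩q∣+∣p∩∁q∣ S (peel k)) (∣S∣≤∣S∩peel∣+k*OPT[S] k))
    where
    ∣S∣≤∣S∩peel∣+k*OPT[S] : ∀ k → ∣ S ∣ ≤ ∣ S ∩ peel k ∣ + k * OPT G S
    ∣S∣≤∣S∩peel∣+k*OPT[S] zero    = ℕ.≤-reflexive (trans (cong ∣_∣ (sym (∩-identityʳ S))) (sym (ℕ.+-identityʳ _)))
    ∣S∣≤∣S∩peel∣+k*OPT[S] (suc k) = begin
      ∣ S ∣                                        ≤⟨ ∣S∣≤∣S∩peel∣+k*OPT[S] k ⟩
      ∣ S ∩ P ∣ + k * OPT G S                      ≤⟨ ℕ.+-monoˡ-≤ (k * OPT G S) (∣S∩T∣≤OPT[S]+∣S∩[T∖L]∣ G S P L-ind) ⟩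
      OPT G S + ∣ S ∩ peel (suc k) ∣ + k * OPT G S  ≡⟨ regroup (OPT G S) ∣ S ∩ peel (suc k) ∣ (k * OPT G S) ⟩
      ∣ S ∩ peel (suc k) ∣ + suc k * OPT G S       ∎
      where
      open ℕ.≤-Reasoning
      P = peel k
      L-ind = proj₁ (proj₂ (OPT-attained G P))
      regroup : ∀ a b c → a + b + c ≡ b + (a + c)
      regroup = solve-∀

-- The relaxation

-- Arguments: whether v ∈ T, and whether v ∈ I (resp. v ∈ S).
coordinate slope : Bool → Bool → Bool
coordinate t i = if t then i else not i
slope      t s = if t then not s else s

penalty : ∀ {n} (T S I : Subset n) → ℕ
penalty T S I = sum λ v → bit (slope (lookup T v) (lookup S v)) * bit (coordinate (lookup T v) (lookup I v))

∣I∩S∣+penalty≡∣S∖T∣+∣I∩T∣ : ∀ {n} (T S I : Subset n) → ∣ I ∩ S ∣ + penalty T S I ≡ ∣ S ∩ ∁ T ∣ + ∣ I ∩ T ∣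
∣I∩S∣+penalty≡∣S∖T∣+∣I∩T∣ []      []      []      = refl
∣I∩S∣+penalty≡∣S∖T∣+∣I∩T∣ (t ∷ T) (s ∷ S) (i ∷ I) = begin
  ∣ (i ∧ s) ∷ I ∩ S ∣ + (bit (slope t s) * bit (coordinate t i) + penalty T S I)
    ≡⟨ cong (_+ (bit (slope t s) * bit (coordinate t i) + penalty T S I)) (∣x∷p∣≡bit[x]+∣p∣ (i ∧ s) (I ∩ S)) ⟩
  (bit (i ∧ s) + ∣ I ∩ S ∣) + (bit (slope t s) * bit (coordinate t i) + penalty T S I)
    ≡⟨ +-interchange (bit (i ∧ s)) ∣ I ∩ S ∣ (bit (slope t s) * bit (coordinate t i)) (penalty T S I) ⟩
  (bit (i ∧ s) + bit (slope t s) * bit (coordinate t i)) + (∣ I ∩ S ∣ + penalty T S I)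
    ≡⟨ cong₂ _+_ (vertex t s i) (∣I∩S∣+penalty≡∣S∖T∣+∣I∩T∣ T S I) ⟩
  (bit (s ∧ not t) + bit (i ∧ t)) + (∣ S ∩ ∁ T ∣ + ∣ I ∩ T ∣)
    ≡⟨ +-interchange (bit (s ∧ not t)) (bit (i ∧ t)) ∣ S ∩ ∁ T ∣ ∣ I ∩ T ∣ ⟩
  (bit (s ∧ not t) + ∣ S ∩ ∁ T ∣) + (bit (i ∧ t) + ∣ I ∩ T ∣)
    ≡⟨ sym (cong₂ _+_ (∣x∷p∣≡bit[x]+∣p∣ (s ∧ not t) (S ∩ ∁ T)) (∣x∷p∣≡bit[x]+∣p∣ (i ∧ t) (I ∩ T))) ⟩
  ∣ (s ∧ not t) ∷ S ∩ ∁ T ∣ + ∣ (i ∧ t) ∷ I ∩ T ∣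
    ∎
  where
  open ≡-Reasoning
  vertex : ∀ t s i → bit (i ∧ s) + bit (slope t s) * bit (coordinate t i) ≡ bit (s ∧ not t) + bit (i ∧ t)
  vertex true  true  true  = refl
  vertex true  true  false = refl
  vertex true  false true  = refl
  vertex true  false false = refl
  vertex false true  true  = refl
  vertex false true  false = refl
  vertex false false true  = refl
  vertex false false false = refl

module SqrtRelaxation {n} (G : Graph n) where
  open Peeling G

  s : ℕ
  s = proj₁ (isqrt n)

  s²≤n : s * s ≤ n
  s²≤n = proj₁ (proj₂ (isqrt n))

  n<[1+s]² : n < suc s * suc s
  n<[1+s]² = proj₂ (proj₂ (isqrt n))

  T : Subset n
  T = peel s

  α : ℕ
  α = OPT G T

  α≤s : α ≤ s
  α≤s = ℕ.<⇒≤pred (ℕ.*-cancelˡ-< (suc s) α (suc s) (ℕ.≤-<-trans [1+s]α≤n n<[1+s]²))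
    where
    open ℕ.≤-Reasoning
    [1+s]α≤n : suc s * α ≤ n
    [1+s]α≤n = begin
      α + s * α     ≡⟨ ℕ.+-comm α (s * α) ⟩
      s * α + α     ≤⟨ ℕ.+-monoʳ-≤ (s * α) (OPT≤∣S∣ G T) ⟩
      s * α + ∣ T ∣ ≤⟨ k*OPT[peel]+∣peel∣≤n s ⟩
      n             ∎

  encode : Subset n → Fin (suc n) → ℕ
  encode I Fin.zero    = α ∸ ∣ I ∩ T ∣
  encode I (Fin.suc v) = bit (coordinate (lookup T v) (lookup I v))

  slopes : Subset n → Fin (suc n) → ℕ
  slopes S Fin.zero    = 1
  slopes S (Fin.suc v) = bit (slope (lookup T v) (lookup S v))

  budget : Subset n → ℕ
  budget S = ∣ S ∩ ∁ T ∣ + α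

  objective : Subset n → ℕ → Affine (suc n)
  objective S zero    = ℕ-affine 0 (λ _ → 0)
  objective S (suc _) = ℕ-affine (budget S) (slopes S)

  budget≡Val+Σslopes*encode : ∀ S I → IsIndependent G I → budget S ≡ Val S I + sum (λ j → slopes S j * encode I j)
  budget≡Val+Σslopes*encode S I I-ind = begin
    ∣ S ∩ ∁ T ∣ + α                            ≡⟨ cong (∣ S ∩ ∁ T ∣ +_) (sym (ℕ.m+[n∸m]≡n (Val≤OPT G T I I-ind))) ⟩
    ∣ S ∩ ∁ T ∣ + (∣ I ∩ T ∣ + (α ∸ ∣ I ∩ T ∣))  ≡⟨ sym (ℕ.+-assoc ∣ S ∩ ∁ T ∣ ∣ I ∩ T ∣ (α ∸ ∣ I ∩ T ∣)) ⟩
    ∣ S ∩ ∁ T ∣ + ∣ I ∩ T ∣ + (α ∸ ∣ I ∩ T ∣)    ≡⟨ cong (_+ (α ∸ ∣ I ∩ T ∣)) (sym (∣I∩S∣+penalty≡∣S∖T∣+∣I∩T∣ T S I)) ⟩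
    ∣ I ∩ S ∣ + penalty T S I + (α ∸ ∣ I ∩ T ∣)  ≡⟨ regroup ∣ I ∩ S ∣ (penalty T S I) (α ∸ ∣ I ∩ T ∣) ⟩
    ∣ I ∩ S ∣ + (1 * (α ∸ ∣ I ∩ T ∣) + penalty T S I) ∎
    where
    open ≡-Reasoning
    regroup : ∀ a p c → a + p + c ≡ a + (1 * c + p)
    regroup = solve-∀

  objective-exact : ∀ S I → IsIndependent G I → eval (objective S (OPT G S)) (ℕ→ℚ ∘ encode I) ≡ ℕ→ℚ (Val S I)
  objective-exact S I I-ind with OPT G S | Val≤OPT G S I I-ind
  ... | zero  | Val≤0 = eval-ℕ-affine-ℕ→ℚ 0 (λ _ → 0) (encode I) (Val S I)
                          (sym (cong₂ _+_ (ℕ.n≤0⇒n≡0 Val≤0) (sum-replicate-zero (suc n))))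
  ... | suc _ | _     = eval-ℕ-affine-ℕ→ℚ (budget S) (slopes S) (encode I) (Val S I)
                          (budget≡Val+Σslopes*encode S I I-ind)

  objective-bounded : ∀ S x → Feasible (orthant (suc n)) x →
                      LeTwoSqrtTimes n (eval (objective S (OPT G S)) x) (ℕ→ℚ (OPT G S))
  objective-bounded S x feasible with OPT G S | ∣S∖peel∣≤k*OPT[S] S s
  ... | zero  | _ = inj₁ (eval-ℕ-affine≤ 0 (λ _ → 0) x (feasible-orthant⁻ feasible))
  ... | suc a | ∣S∖T∣≤s[1+a] =
    LeTwoSqrtTimes-intro n (budget S) (suc a) (eval-ℕ-affine≤ (budget S) (slopes S) x (feasible-orthant⁻ feasible))
      (b≤2sz⇒b²≤4nz² {s = s} (suc a) (ℕ.+-mono-≤ ∣S∖T∣≤s[1+a] (ℕ.≤-trans α≤s (ℕ.m≤m*n s (suc a)))) s²≤n)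

  relaxation : Factor2SqrtNRelaxation G (suc n)
  relaxation = record
    { d        = suc n
    ; system   = orthant (suc n)
    ; embed    = λ I → ℕ→ℚ ∘ encode I
    ; embed-ok = λ I _ → feasible-orthant⁺ (ℕ→ℚ-nonNeg ∘ encode I)
    ; obj      = λ S → objective S (OPT G S)
    ; obj-ok   = objective-exact
    ; bound    = objective-bounded
    }

relaxation₀ : (G : Graph 0) → Factor2SqrtNRelaxation G 0
relaxation₀ G = record
  { d        = 0
  ; system   = record { A = λ () ; b = λ () }
  ; embed    = λ _ ()
  ; embed-ok = λ _ _ ()
  ; obj      = λ _ → record { c0 = 0ℚ ; c = λ () }
  ; obj-ok   = λ { [] [] _ → refl }
  ; bound    = λ _ _ _ → inj₁ QP.≤-refl
  }

2+n≤2*[1+n] : ∀ n → suc (suc n) ≤ 2 * suc n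
2+n≤2*[1+n] n = subst (suc n <_) (ℕ.*-comm (suc n) 2) (ℕ.m<m*n (suc n) 2 (s≤s (s≤s z≤n)))

theorem5 : Σ ℕ λ C → ∀ (n : ℕ) (G : Graph n) →
             ∃ λ m → (m ≤ C * n) × Factor2SqrtNRelaxation G m
theorem5 = 2 , λ where
  zero    G → 0 , z≤n , relaxation₀ G
  (suc n) G → suc (suc n) , 2+n≤2*[1+n] n , SqrtRelaxation.relaxation G
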